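{- Fix an integer $n\ge 2$. Then, as the integer $k$ tends to infinity, $$\alpha\left(k,\frac{n}{n-1}\right)\ge k+1-n-\frac{n-1}{k}+O\left(\frac{1}{k^2}\right)$$ and $$\alpha\left(k,\left(\frac{n}{n-1}\right)^+\right)\ge k+2-n-\frac{n-1}{k}+O\left(\frac{1}{k^2}\right).$$ That is, there exist constants $C>0$ and $K$ (depending on $n$) such that for all integers $k\ge K$, $\alpha\left(k,\frac{n}{n-1}\right)\ge k+1-n-\frac{n-1}{k}-\frac{C}{k^2}$ and $\alpha\left(k,\left(\frac{n}{n-1}\right)^+\right)\ge k+2-n-\frac{n-1}{k}-\frac{C}{k^2}$.
   Context: A word of the form $w=xx\cdots xy$, where $x$ is a non-empty word and $y$ is a prefix of $x$ (possibly empty), is called a power of exponent $|w|/|x|$ and period $|x|$. For a real $\beta>1$, a word is $\beta$-free if it has no factor (contiguous subword) that is a power of exponent $\gamma$ with $\gamma\ge\beta$, and it is $\beta^+$-free if it has no factor that is a power of exponent $\gamma$ with $\gamma>\beta$. For a positive integer $k$, $\alpha(k,\beta)$ denotes the growth rate $\lim_{m\to\infty}|L_m|^{1/m}$, where $L_m$ is the set of $\beta$-free words of length $m$ over the alphabet $\{1,2,\ldots,k\}$; similarly $\alpha(k,\beta^+)$ is the growth rate of the set of $\beta^+$-free words over $\{1,\ldots,k\}$ (these limits exist since the languages are factorial). -}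

module Defs where

open import Data.Nat as ℕ using (ℕ; zero; suc; _≤_; s≤s; z≤n)
open import Data.Integer using (+_)
open import Data.Rational as ℚ using (ℚ; _/_; 0ℚ; 1ℚ)
open import Data.Fin using (Fin)
open import Data.List using (List; []; _∷_; _++_; length; concat; replicate)
open import Data.List.Relation.Unary.All using (All)
open import Data.List.Relation.Unary.Unique.Propositional using (Unique)
open import Data.Product using (Σ; ∃; _×_)
open import Relation.Binary.PropositionalEquality using (_≡_)
open import Relation.Nullary using (¬_)

Word : ℕ → Set
Word k = List (Fin k)

_^ℚ_ : ℚ → ℕ → ℚ
q ^ℚ zero  = 1ℚ
q ^ℚ suc m = q ℚ.* (q ^ℚ m)

-- w is a power of exponent γ: w = x x ⋯ x y with x = c ∷ x' non-empty,
-- j copies of x, y a prefix of x, and γ = |w| / |x|.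
IsPowerOfExp : ∀ {k} → Word k → ℚ → Set
IsPowerOfExp {k} w γ =
  Σ (Fin k) λ c → Σ (Word k) λ x' → Σ ℕ λ j → Σ (Word k) λ y → Σ (Word k) λ z →
    (c ∷ x') ≡ y ++ z ×
    w ≡ concat (replicate j (c ∷ x')) ++ y ×
    γ ≡ (+ length w) / length (c ∷ x')

HasPowerFactor : ∀ {k} → (ℚ → Set) → Word k → Set
HasPowerFactor {k} P u =
  Σ (Word k) λ a → Σ (Word k) λ w → Σ (Word k) λ b → Σ ℚ λ γ →
    u ≡ a ++ w ++ b × IsPowerOfExp w γ × P γ

Free : ∀ {k} → ℚ → Word k → Set
Free β u = ¬ HasPowerFactor (λ γ → β ℚ.≤ γ) u

Free⁺ : ∀ {k} → ℚ → Word k → Set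
Free⁺ β u = ¬ HasPowerFactor (λ γ → β ℚ.< γ) u

-- "There are at least N words of length m satisfying F": a duplicate-free
-- list of such words of length N (L_m is finite, so this says |L_m| ≥ N).
AtLeastWords : ∀ {k} → (Word k → Set) → ℕ → ℚ → Set
AtLeastWords {k} F m bound =
  Σ (List (Word k)) λ ws →
    Unique ws × All (λ u → length u ≡ m × F u) ws × bound ℚ.≤ (+ length ws) / 1

-- The growth rate α = lim_m |L_m|^{1/m} of the factorial language given by F
-- (whose existence is assumed, as in the paper) satisfies α ≥ r.
GrowthRateAtLeast : ∀ {k} → (Word k → Set) → ℚ → Set
GrowthRateAtLeast {k} F r =
  ∀ (q : ℚ) → 0ℚ ℚ.≤ q → q ℚ.< r →
    ∃ λ (M : ℕ) → ∀ (m : ℕ) → M ≤ m → AtLeastWords F m (q ^ℚ m)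

nOverNm1 : (n : ℕ) → 2 ≤ n → ℚ
nOverNm1 (suc (suc m)) _ = (+ suc (suc m)) / suc m
nOverNm1 (suc zero) (s≤s ())

module Submission where

-- Put d = n - 1 and s = 1 (resp. s = 0).  A word
-- is avoiding if none of its suffixes begins with a repetition of period
-- p = q d + r + s (q ≥ 0, r < d) and length p + q + 1.  Every power of exponent
-- ≥ n/(n-1) (resp. > n/(n-1)) is such a repetition, so avoiding words are free.
-- When an avoiding word of length m is extended by one letter, a letter that
-- fails creates a forbidden repetition, which determines it; this gives, for
-- the number a(m) of avoiding words of length m, the recurrence
--   H a(m) ≤ a(m + 1) + d (a(m - 1) + ⋯ + a(0)),   H = k - (d - 1 + s).
-- Such a recurrence forces a(m + 1) ≥ (P / Q) a(m) whenever Q² + Q ≤ P and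
-- P + d = Q H, so the growth rate is at least P / Q = H - d / Q; the choice
-- Q = k - 2n makes this at least H - d / k - 4n² / k² once k ≥ 4n.

module Sums where
  open import Data.Nat using (ℕ; zero; suc; _+_; _*_; _∸_; _≤_; _<_; z≤n; s≤s)
  open import Data.Nat.Properties
  open import Data.Bool using (Bool; true; false; _∧_; not)
  open import Data.Bool.Properties using (∧-identityʳ; ∧-zeroʳ; ∧-conicalˡ; ∧-conicalʳ)
  open import Data.List using (List; []; _∷_; _++_; map; length)
  open import Data.List.Relation.Unary.All using (All; []; _∷_)
  open import Relation.Binary.PropositionalEquality
  open import Data.Nat.Tactic.RingSolver using (solve-∀)

  ⟦_⟧ : Bool → ℕ
  ⟦ true ⟧  = 1
  ⟦ false ⟧ = 0

  ⟦⟧≤1 : ∀ b → ⟦ b ⟧ ≤ 1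
  ⟦⟧≤1 true  = s≤s z≤n
  ⟦⟧≤1 false = z≤n

  ⟦∧⟧≤ˡ : ∀ x y → ⟦ x ∧ y ⟧ ≤ ⟦ x ⟧
  ⟦∧⟧≤ˡ true  y = ⟦⟧≤1 y
  ⟦∧⟧≤ˡ false y = z≤n

  ⟦∧⟧≤ʳ : ∀ x y → ⟦ x ∧ y ⟧ ≤ ⟦ y ⟧
  ⟦∧⟧≤ʳ true  y = ≤-refl
  ⟦∧⟧≤ʳ false y = z≤n

  ⟦⟧*-≤ : ∀ b {x y} → (b ≡ true → x ≤ y) → ⟦ b ⟧ * x ≤ y
  ⟦⟧*-≤ true  {x} h = ≤-trans (≤-reflexive (*-identityˡ x)) (h refl)
  ⟦⟧*-≤ false     h = z≤n

  sumBelow : ℕ → (ℕ → ℕ) → ℕ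
  sumBelow zero    f = 0
  sumBelow (suc n) f = f 0 + sumBelow n (λ i → f (suc i))

  syntax sumBelow n (λ i → e) = ∑[ i < n ] e

  sumOver : {A : Set} → List A → (A → ℕ) → ℕ
  sumOver []       f = 0
  sumOver (x ∷ xs) f = f x + sumOver xs f

  syntax sumOver xs (λ x → e) = ∑[ x ∈ xs ] e

  count : {A : Set} → (A → Bool) → List A → ℕ
  count p xs = ∑[ x ∈ xs ] ⟦ p x ⟧

  -- a (m - 1) + ⋯ + a 1 + a 0, unfolding as prefixSum a (m + 1) = a m + prefixSum a m.
  prefixSum : (ℕ → ℕ) → ℕ → ℕ
  prefixSum a m = ∑[ q < m ] a (m ∸ suc q)

  allBelow : ℕ → (ℕ → Bool) → Bool
  allBelow zero    b = true
  allBelow (suc n) b = b 0 ∧ allBelow n (λ i → b (suc i))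

  private
    interchange : ∀ a b c d → a + b + (c + d) ≡ a + c + (b + d)
    interchange = solve-∀

  module _ {A : Set} where

    sumOver-++ : ∀ (f : A → ℕ) xs ys → sumOver (xs ++ ys) f ≡ sumOver xs f + sumOver ys f
    sumOver-++ f []       ys = refl
    sumOver-++ f (x ∷ xs) ys = trans (cong (f x +_) (sumOver-++ f xs ys)) (sym (+-assoc (f x) _ _))

    sumOver-map : ∀ {B : Set} (f : B → ℕ) (g : A → B) xs → sumOver (map g xs) f ≡ ∑[ x ∈ xs ] f (g x)
    sumOver-map f g []       = refl
    sumOver-map f g (x ∷ xs) = cong (f (g x) +_) (sumOver-map f g xs)

    sumOver-cong : ∀ (f g : A → ℕ) xs → (∀ x → f x ≡ g x) → sumOver xs f ≡ sumOver xs g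
    sumOver-cong f g []       h = refl
    sumOver-cong f g (x ∷ xs) h = cong₂ _+_ (h x) (sumOver-cong f g xs h)

    sumOver-mono-All : ∀ {P : A → Set} (f g : A → ℕ) xs → All P xs →
                       (∀ x → P x → f x ≤ g x) → sumOver xs f ≤ sumOver xs g
    sumOver-mono-All f g []       []         h = z≤n
    sumOver-mono-All f g (x ∷ xs) (px ∷ pxs) h = +-mono-≤ (h x px) (sumOver-mono-All f g xs pxs h)

    sumOver-mono : ∀ (f g : A → ℕ) xs → (∀ x → f x ≤ g x) → sumOver xs f ≤ sumOver xs g
    sumOver-mono f g []       h = z≤n
    sumOver-mono f g (x ∷ xs) h = +-mono-≤ (h x) (sumOver-mono f g xs h)

    sumOver-+ : ∀ (f g : A → ℕ) xs → ∑[ x ∈ xs ] (f x + g x) ≡ sumOver xs f + sumOver xs g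
    sumOver-+ f g []       = refl
    sumOver-+ f g (x ∷ xs) rewrite sumOver-+ f g xs = interchange (f x) (g x) (sumOver xs f) (sumOver xs g)

    sumOver-*ʳ : ∀ (f : A → ℕ) c xs → ∑[ x ∈ xs ] (f x * c) ≡ sumOver xs f * c
    sumOver-*ʳ f c []       = refl
    sumOver-*ʳ f c (x ∷ xs) rewrite sumOver-*ʳ f c xs = sym (*-distribʳ-+ c (f x) (sumOver xs f))

    sumOver-const-1 : ∀ (xs : List A) → ∑[ x ∈ xs ] 1 ≡ length xs
    sumOver-const-1 []       = refl
    sumOver-const-1 (x ∷ xs) = cong suc (sumOver-const-1 xs)

    count-false : ∀ xs → count (λ (_ : A) → false) xs ≡ 0
    count-false []       = refl
    count-false (x ∷ xs) = count-false xs

    count-∧-const : ∀ (p : A → Bool) b xs → count (λ x → p x ∧ b) xs ≤ count p xs * ⟦ b ⟧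
    count-∧-const p true  xs = ≤-reflexive (trans (sumOver-cong _ _ xs λ x → cong ⟦_⟧ (∧-identityʳ (p x)))
                                                   (sym (*-identityʳ _)))
    count-∧-const p false xs = ≤-reflexive (trans (sumOver-cong _ _ xs λ x → cong ⟦_⟧ (∧-zeroʳ (p x)))
                                                   (trans (count-false xs) (sym (*-zeroʳ (count p xs)))))

  sumBelow-+ : ∀ n (f g : ℕ → ℕ) → ∑[ i < n ] (f i + g i) ≡ sumBelow n f + sumBelow n g
  sumBelow-+ zero    f g = refl
  sumBelow-+ (suc n) f g rewrite sumBelow-+ n (λ i → f (suc i)) (λ i → g (suc i)) = interchange (f 0) (g 0) _ _

  sumBelow-cong : ∀ n (f g : ℕ → ℕ) → (∀ i → f i ≡ g i) → sumBelow n f ≡ sumBelow n g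
  sumBelow-cong zero    f g h = refl
  sumBelow-cong (suc n) f g h = cong₂ _+_ (h 0) (sumBelow-cong n _ _ λ i → h (suc i))

  sumBelow-mono : ∀ n (f g : ℕ → ℕ) → (∀ i → f i ≤ g i) → sumBelow n f ≤ sumBelow n g
  sumBelow-mono zero    f g h = z≤n
  sumBelow-mono (suc n) f g h = +-mono-≤ (h 0) (sumBelow-mono n _ _ λ i → h (suc i))

  sumBelow-mono-< : ∀ n (f g : ℕ → ℕ) → (∀ i → i < n → f i ≤ g i) → sumBelow n f ≤ sumBelow n g
  sumBelow-mono-< zero    f g h = z≤n
  sumBelow-mono-< (suc n) f g h = +-mono-≤ (h 0 (s≤s z≤n)) (sumBelow-mono-< n _ _ λ i i<n → h (suc i) (s≤s i<n))

  sumBelow-const : ∀ n c → ∑[ i < n ] c ≡ n * c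
  sumBelow-const zero    c = refl
  sumBelow-const (suc n) c = cong (c +_) (sumBelow-const n c)

  sumBelow-*ʳ : ∀ n (f : ℕ → ℕ) c → ∑[ i < n ] (f i * c) ≡ sumBelow n f * c
  sumBelow-*ʳ zero    f c = refl
  sumBelow-*ʳ (suc n) f c = trans (cong (f 0 * c +_) (sumBelow-*ʳ n (λ i → f (suc i)) c))
                                  (sym (*-distribʳ-+ c (f 0) _))

  sumBelow-*ˡ : ∀ n (f : ℕ → ℕ) c → ∑[ i < n ] (c * f i) ≡ c * sumBelow n f
  sumBelow-*ˡ zero    f c = sym (*-zeroʳ c)
  sumBelow-*ˡ (suc n) f c = trans (cong (c * f 0 +_) (sumBelow-*ˡ n (λ i → f (suc i)) c))
                                  (sym (*-distribˡ-+ c (f 0) _))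

  sumOver-sumBelow : ∀ {A : Set} n (g : A → ℕ → ℕ) xs →
                     ∑[ x ∈ xs ] sumBelow n (g x) ≡ ∑[ i < n ] ∑[ x ∈ xs ] g x i
  sumOver-sumBelow n g []       = sym (trans (sumBelow-const n 0) (*-zeroʳ n))
  sumOver-sumBelow n g (x ∷ xs) rewrite sumOver-sumBelow n g xs =
    sym (sumBelow-+ n (g x) (λ i → ∑[ y ∈ xs ] g y i))

  allBelow-union : ∀ n (b : ℕ → Bool) → 1 ≤ ⟦ allBelow n b ⟧ + ∑[ i < n ] ⟦ not (b i) ⟧
  allBelow-union zero    b = s≤s z≤n
  allBelow-union (suc n) b with b 0
  ... | true  = allBelow-union n (λ i → b (suc i))
  ... | false = s≤s z≤n

  someBelow-union : ∀ n (b : ℕ → Bool) → ⟦ not (allBelow n (λ i → not (b i))) ⟧ ≤ ∑[ i < n ] ⟦ b i ⟧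
  someBelow-union zero    b = z≤n
  someBelow-union (suc n) b with b 0
  ... | false = someBelow-union n (λ i → b (suc i))
  ... | true  = s≤s z≤n

  union-bound² : ∀ n m (b : ℕ → ℕ → Bool) →
    1 ≤ ⟦ allBelow n (λ i → allBelow m (λ j → not (b i j))) ⟧ + ∑[ i < n ] ∑[ j < m ] ⟦ b i j ⟧
  union-bound² n m b = ≤-trans (allBelow-union n _)
    (+-monoʳ-≤ _ (sumBelow-mono n _ _ λ i → someBelow-union m (b i)))

  allBelow-elim : ∀ n (b : ℕ → Bool) → allBelow n b ≡ true → ∀ i → i < n → b i ≡ true
  allBelow-elim (suc n) b h zero    _         = ∧-conicalˡ (b 0) _ h
  allBelow-elim (suc n) b h (suc i) (s≤s i<n) = allBelow-elim n (λ i → b (suc i)) (∧-conicalʳ (b 0) _ h) i i<n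

  allBelow-intro : ∀ n (b : ℕ → Bool) → (∀ i → i < n → b i ≡ true) → allBelow n b ≡ true
  allBelow-intro zero    b h = refl
  allBelow-intro (suc n) b h rewrite h 0 (s≤s z≤n) =
    allBelow-intro n (λ i → b (suc i)) (λ i i<n → h (suc i) (s≤s i<n))

module Periodicity where
  open import Data.Nat using (ℕ; zero; suc; _+_; _≤_; _<_; z≤n; s≤s)
  open import Data.Nat.Properties hiding (_≟_)
  open import Data.Bool using (Bool; true; false)
  open import Data.Fin using (Fin; zero; suc; _≟_)
  open import Data.List using (List; []; _∷_; _++_; length; concat; replicate; allFin)
  open import Data.List.Properties using (++-assoc; length-++; map-tabulate)
  open import Data.Maybe using (Maybe; just; nothing)
  open import Data.Product using (Σ; _,_; _×_; proj₁; proj₂)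
  open import Data.Empty using (⊥-elim)
  open import Function using (id; _∘_)
  open import Relation.Nullary using (does)
  open import Relation.Nullary.Decidable using (dec-true)
  open import Relation.Binary.PropositionalEquality
  open import Defs using (Word)
  open Sums

  _at_ : {A : Set} → List A → ℕ → Maybe A
  []       at i     = nothing
  (x ∷ xs) at zero  = just x
  (x ∷ xs) at suc i = xs at i

  at-++ˡ : ∀ {A : Set} (xs ys : List A) i → i < length xs → (xs ++ ys) at i ≡ xs at i
  at-++ˡ (x ∷ xs) ys zero    _         = refl
  at-++ˡ (x ∷ xs) ys (suc i) (s≤s i<n) = at-++ˡ xs ys i i<n

  at-++ʳ : ∀ {A : Set} (xs ys : List A) i → (xs ++ ys) at (length xs + i) ≡ ys at i
  at-++ʳ []       ys i = refl
  at-++ʳ (x ∷ xs) ys i = at-++ʳ xs ys i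

  at-defined : ∀ {A : Set} (xs : List A) i → i < length xs → Σ A λ x → xs at i ≡ just x
  at-defined (x ∷ xs) zero    _         = x , refl
  at-defined (x ∷ xs) (suc i) (s≤s i<n) = at-defined xs i i<n

  sameLetter : ∀ {k} → Maybe (Fin k) → Maybe (Fin k) → Bool
  sameLetter (just a) (just b) = does (a ≟ b)
  sameLetter _        _        = false

  hasPeriod : ∀ {k} → ℕ → ℕ → Word k → Bool
  hasPeriod p q w = allBelow q (λ i → sameLetter (w at i) (w at (i + p)))

  count-allFin-suc : ∀ {k} (b : Fin (suc k) → Bool) →
                     count b (allFin (suc k)) ≡ ⟦ b zero ⟧ + count (b ∘ suc) (allFin k)
  count-allFin-suc {k} b = cong (⟦ b zero ⟧ +_)
    (trans (cong (count b) (sym (map-tabulate id suc))) (sumOver-map _ suc (allFin k)))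

  -- At most one letter agrees with a given position.  This is why a period
  -- forced on a word leaves no freedom for the next letter.
  count-sameLetter : ∀ {k} (t : Maybe (Fin k)) → count (λ c → sameLetter (just c) t) (allFin k) ≤ 1
  count-sameLetter {k} nothing = ≤-trans (≤-reflexive (count-false (allFin k))) z≤n
  count-sameLetter (just b) = count-≟ b
    where
      count-≟ : ∀ {k} (b : Fin k) → count (λ c → does (c ≟ b)) (allFin k) ≤ 1
      count-≟ {suc k} zero    = ≤-reflexive (trans (count-allFin-suc {k} (λ c → does (c ≟ zero)))
                                                     (cong suc (count-false (allFin k))))
      count-≟ {suc k} (suc b) = ≤-trans (≤-reflexive (count-allFin-suc {k} (λ c → does (c ≟ suc b)))) (count-≟ b)

  power-shift : ∀ {A : Set} (X y z : List A) → X ≡ y ++ z → ∀ j →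
    Σ (List A) λ t → X ++ (concat (replicate j X) ++ y) ≡ (concat (replicate j X) ++ y) ++ t
  power-shift X y z X≡yz zero    = z ++ y , trans (cong (_++ y) X≡yz) (++-assoc y z y)
  power-shift X y z X≡yz (suc j) with power-shift X y z X≡yz j
  ... | t , shift = t , (begin
      X ++ ((X ++ C) ++ y) ≡⟨ cong (X ++_) (++-assoc X C y) ⟩
      X ++ (X ++ (C ++ y)) ≡⟨ cong (X ++_) shift ⟩
      X ++ ((C ++ y) ++ t) ≡⟨ sym (++-assoc X (C ++ y) t) ⟩
      (X ++ (C ++ y)) ++ t ≡⟨ cong (_++ t) (sym (++-assoc X C y)) ⟩
      ((X ++ C) ++ y) ++ t ∎)
    where open ≡-Reasoning
          C = concat (replicate j X)

  power-periodic : ∀ {A : Set} (X y z : List A) → X ≡ y ++ z → ∀ j i →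
    let w = concat (replicate j X) ++ y in
    i + length X < length w → w at i ≡ w at (i + length X)
  power-periodic X y z X≡yz zero i short = ⊥-elim (<-irrefl refl (<-≤-trans short y≤i+X))
    where y≤i+X : length y ≤ i + length X
          y≤i+X = ≤-trans (m≤m+n (length y) (length z))
                    (≤-trans (≤-reflexive (trans (sym (length-++ y)) (cong length (sym X≡yz))))
                             (m≤n+m (length X) i))
  power-periodic X y z X≡yz (suc j) i inside = begin
      w at i               ≡⟨ cong (_at i) w≡ ⟩
      (X ++ w') at i       ≡⟨ cong (_at i) (proj₂ (power-shift X y z X≡yz j)) ⟩
      (w' ++ t) at i       ≡⟨ at-++ˡ w' t i i<w' ⟩
      w' at i              ≡⟨ sym (at-++ʳ X w' i) ⟩
      (X ++ w') at (length X + i) ≡⟨ cong₂ _at_ (sym w≡) (+-comm (length X) i) ⟩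
      w at (i + length X)  ∎
    where open ≡-Reasoning
          w' = concat (replicate j X) ++ y
          w = concat (replicate (suc j) X) ++ y
          w≡ : w ≡ X ++ w'
          w≡ = ++-assoc X (concat (replicate j X)) y
          t = proj₁ (power-shift X y z X≡yz j)
          i<w' : i < length w'
          i<w' = +-cancelˡ-< (length X) i (length w')
                   (≤-trans (≤-trans (≤-reflexive (cong suc (+-comm (length X) i))) inside)
                            (≤-reflexive (trans (cong length w≡) (length-++ X))))

  hasPeriod-intro : ∀ {k} p q (v : Word k) →
    (∀ i → i < q → i + p < length v × v at i ≡ v at (i + p)) → hasPeriod p q v ≡ true
  hasPeriod-intro p q v recur = allBelow-intro q _ λ i i<q →
    let (i+p<v , vi≡vi+p) = recur i i<q
        (x , vi≡x) = at-defined v i (≤-<-trans (m≤m+n i p) i+p<v)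
    in subst₂ (λ m₁ m₂ → sameLetter m₁ m₂ ≡ true) (sym vi≡x) (trans (sym vi≡x) vi≡vi+p)
              (dec-true (x ≟ x) refl)

module Avoidance where
  open import Data.Nat using (ℕ; zero; suc; _+_; _*_; _∸_; _≤_; _<_; _≤ᵇ_; z≤n; s≤s; NonZero)
  open import Data.Nat.DivMod using (_/_; _%_; m≡m%n+[m/n]*n; m%n<n)
  open import Data.Nat.Properties
  open import Data.Bool using (Bool; true; false; _∧_; not)
  open import Data.Bool.Properties using (∧-assoc; ∧-identityʳ; ∧-zeroʳ; ∧-conicalˡ; ∧-conicalʳ)
  open import Data.Fin using (Fin)
  open import Data.Maybe using (just)
  open import Data.List using (List; []; _∷_; _++_; length; map; allFin; cartesianProductWith; concat; replicate)
  open import Data.Product using (_,_)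
  open import Data.Empty using (⊥)
  open import Data.List.Properties using (length-tabulate; length-++)
  open import Data.List.Relation.Unary.All as All using (All; []; _∷_)
  import Data.List.Relation.Unary.All.Properties as All
  open import Relation.Binary.PropositionalEquality
  open import Data.Nat.Tactic.RingSolver using (solve-∀)
  open import Defs using (Word)
  open Sums
  open Periodicity

  repeats : ∀ {k} → ℕ → ℕ → Word k → Bool
  repeats p q w = (1 ≤ᵇ p) ∧ hasPeriod p q w

  -- Prolonging a repetition to the left by a letter c is possible for at most
  -- one c: it must equal the letter p positions further on.
  repeats-extensions : ∀ {k} p q (u : Word k) →
    count (λ c → repeats p (suc q) (c ∷ u)) (allFin k) ≤ ⟦ repeats p q u ⟧
  repeats-extensions {k} zero q u = ≤-reflexive (count-false (allFin k))
  repeats-extensions {k} (suc p) q u = begin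
    count (λ c → sameLetter (just c) (u at p) ∧ hasPeriod (suc p) q u) (allFin k)
      ≤⟨ count-∧-const _ (hasPeriod (suc p) q u) (allFin k) ⟩
    count (λ c → sameLetter (just c) (u at p)) (allFin k) * ⟦ hasPeriod (suc p) q u ⟧
      ≤⟨ *-monoˡ-≤ ⟦ hasPeriod (suc p) q u ⟧ (count-sameLetter (u at p)) ⟩
    1 * ⟦ hasPeriod (suc p) q u ⟧
      ≡⟨ *-identityˡ _ ⟩
    ⟦ hasPeriod (suc p) q u ⟧ ∎
    where open ≤-Reasoning

  guarded-extensions : ∀ {k} b p q (u : Word k) →
    count (λ c → b ∧ repeats p (suc q) (c ∷ u)) (allFin k) ≤ ⟦ b ∧ repeats p q u ⟧
  guarded-extensions {k} true  p q u = repeats-extensions p q u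
  guarded-extensions {k} false p q u = ≤-reflexive (count-false (allFin k))

  -- For q ≥ 0 and r < d the pair (q, r) stands for the period p = q d + r + s,
  -- and a repetition of period p and length p + q + 1 is forbidden.
  module AvoidingWords (k d s : ℕ) where

    period : ℕ → ℕ → ℕ
    period q r = q * d + r + s

    forbidden : ℕ → ℕ → Word k → Bool
    forbidden q r w = repeats (period q r) (suc q) w

    -- w begins with no forbidden repetition (longer ones cannot fit in w).
    cleanStart : Word k → Bool
    cleanStart w = allBelow (length w) (λ q → allBelow d (λ r → not (forbidden q r w)))

    avoiding : Word k → Bool
    avoiding []      = true
    avoiding (c ∷ u) = cleanStart (c ∷ u) ∧ avoiding u

    extend : List (Word k) → List (Word k)
    extend us = cartesianProductWith (λ u c → c ∷ u) us (allFin k)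

    extendN : ℕ → List (Word k) → List (Word k)
    extendN zero    us = us
    extendN (suc q) us = extend (extendN q us)

    words : ℕ → List (Word k)
    words m = extendN m ([] ∷ [])

    size : ℕ → ℕ
    size m = count avoiding (words m)

    count-extend : ∀ (b : Word k → Bool) us →
                   count b (extend us) ≡ ∑[ u ∈ us ] count (λ c → b (c ∷ u)) (allFin k)
    count-extend b []       = refl
    count-extend b (u ∷ us) = trans (sumOver-++ _ (map (_∷ u) (allFin k)) (extend us))
                                    (cong₂ _+_ (sumOver-map _ (_∷ u) (allFin k)) (count-extend b us))

    extendN-+ : ∀ q m us → extendN q (extendN m us) ≡ extendN (q + m) us
    extendN-+ zero    m us = refl
    extendN-+ (suc q) m us = cong extend (extendN-+ q m us)

    words-length : ∀ m → All (λ u → length u ≡ m) (words m)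
    words-length zero    = refl ∷ []
    words-length (suc m) = all-extend (words m) (words-length m)
      where
        all-extend : ∀ us → All (λ u → length u ≡ m) us → All (λ u → length u ≡ suc m) (extend us)
        all-extend []       []         = []
        all-extend (u ∷ us) (eq ∷ eqs) =
          All.++⁺ (All.map⁺ (All.universal (λ c → cong suc eq) (allFin k))) (all-extend us eqs)

    cleanStart-or-forbidden : ∀ w → 1 ≤ ⟦ cleanStart w ⟧ + ∑[ q < length w ] ∑[ r < d ] ⟦ forbidden q r w ⟧
    cleanStart-or-forbidden w = union-bound² (length w) d (λ q r → forbidden q r w)

    avoiding-cons : ∀ c u → avoiding u ≡ true → avoiding (c ∷ u) ≡ cleanStart (c ∷ u)
    avoiding-cons c u eq rewrite eq = ∧-identityʳ _

    -- Extending an avoiding word u: of the k letters, those not giving an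
    -- avoiding word create a forbidden repetition, which forces the letter
    -- once (q, r) is chosen and requires u to begin with a repetition.
    extensions-bound : ∀ u → ⟦ avoiding u ⟧ * k ≤ count (λ c → avoiding (c ∷ u)) (allFin k)
        + ∑[ q < suc (length u) ] ∑[ r < d ] ⟦ avoiding u ∧ repeats (period q r) q u ⟧
    extensions-bound u = ⟦⟧*-≤ (avoiding u) λ eq → begin
        k
          ≡⟨ sym (trans (sumOver-const-1 (allFin k)) (length-tabulate (λ c → c))) ⟩
        ∑[ c ∈ allFin k ] 1
          ≤⟨ sumOver-mono _ _ (allFin k) (λ c → cleanStart-or-forbidden (c ∷ u)) ⟩
        ∑[ c ∈ allFin k ] (⟦ cleanStart (c ∷ u) ⟧ + ∑[ q < L ] ∑[ r < d ] ⟦ forbidden q r (c ∷ u) ⟧)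
          ≡⟨ sumOver-+ _ _ (allFin k) ⟩
        count (λ c → cleanStart (c ∷ u)) (allFin k) + ∑[ c ∈ allFin k ] ∑[ q < L ] ∑[ r < d ] ⟦ forbidden q r (c ∷ u) ⟧
          ≡⟨ cong₂ _+_ (sumOver-cong _ _ (allFin k) (λ c → cong ⟦_⟧ (sym (avoiding-cons c u eq))))
                       (trans (sumOver-sumBelow L (λ c q → ∑[ r < d ] ⟦ forbidden q r (c ∷ u) ⟧) (allFin k))
                              (sumBelow-cong L _ _ λ q →
                                 sumOver-sumBelow d (λ c r → ⟦ forbidden q r (c ∷ u) ⟧) (allFin k))) ⟩
        count (λ c → avoiding (c ∷ u)) (allFin k) + ∑[ q < L ] ∑[ r < d ] count (λ c → forbidden q r (c ∷ u)) (allFin k)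
          ≤⟨ +-monoʳ-≤ (count (λ c → avoiding (c ∷ u)) (allFin k))
               (sumBelow-mono L _ _ λ q → sumBelow-mono d _ _ λ r → repeats-extensions (period q r) q u) ⟩
        count (λ c → avoiding (c ∷ u)) (allFin k) + ∑[ q < L ] ∑[ r < d ] ⟦ repeats (period q r) q u ⟧
          ≡⟨ cong (count (λ c → avoiding (c ∷ u)) (allFin k) +_)
               (sumBelow-cong L _ _ λ q → sumBelow-cong d _ _ λ r →
                  cong (λ b → ⟦ b ∧ repeats (period q r) q u ⟧) (sym eq)) ⟩
        count (λ c → avoiding (c ∷ u)) (allFin k) + ∑[ q < L ] ∑[ r < d ] ⟦ avoiding u ∧ repeats (period q r) q u ⟧ ∎
      where open ≤-Reasoning
            L = suc (length u)

    -- A word beginning with a repetition of length p + q is determined by its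
    -- last letters: among the q-letter left extensions of an avoiding word, at
    -- most one is avoiding and begins with such a repetition.
    repeating-extensions : ∀ p q vs → count (λ u → avoiding u ∧ repeats p q u) (extendN q vs) ≤ count avoiding vs
    repeating-extensions p zero    vs = sumOver-mono _ _ vs λ v → ⟦∧⟧≤ˡ (avoiding v) (repeats p 0 v)
    repeating-extensions p (suc q) vs = begin
        count (λ u → avoiding u ∧ repeats p (suc q) u) (extend (extendN q vs))
          ≡⟨ count-extend (λ u → avoiding u ∧ repeats p (suc q) u) (extendN q vs) ⟩
        ∑[ u ∈ extendN q vs ] count (λ c → avoiding (c ∷ u) ∧ repeats p (suc q) (c ∷ u)) (allFin k)
          ≤⟨ sumOver-mono _ _ (extendN q vs) (λ u →
               ≤-trans (sumOver-mono _ _ (allFin k) λ c → forget-cleanStart c u)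
                       (guarded-extensions (avoiding u) p q u)) ⟩
        count (λ u → avoiding u ∧ repeats p q u) (extendN q vs)
          ≤⟨ repeating-extensions p q vs ⟩
        count avoiding vs ∎
      where
        open ≤-Reasoning
        forget-cleanStart : ∀ c u → ⟦ avoiding (c ∷ u) ∧ repeats p (suc q) (c ∷ u) ⟧
                                  ≤ ⟦ avoiding u ∧ repeats p (suc q) (c ∷ u) ⟧
        forget-cleanStart c u = ≤-trans (≤-reflexive (cong ⟦_⟧ (∧-assoc (cleanStart (c ∷ u)) _ _)))
                                        (⟦∧⟧≤ʳ (cleanStart (c ∷ u)) _)

    repeating-words : ∀ p q m → q ≤ m →
      count (λ u → avoiding u ∧ repeats p q u) (words m) ≤ ⟦ 1 ≤ᵇ p ⟧ * size (m ∸ q)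
    repeating-words zero    q m _   = ≤-reflexive
      (trans (sumOver-cong _ _ (words m) λ u → cong ⟦_⟧ (∧-zeroʳ (avoiding u))) (count-false (words m)))
    repeating-words (suc p) q m q≤m = begin
        count (λ u → avoiding u ∧ repeats (suc p) q u) (words m)
          ≡⟨ cong (count (λ u → avoiding u ∧ repeats (suc p) q u)) words-split ⟩
        count (λ u → avoiding u ∧ repeats (suc p) q u) (extendN q (words (m ∸ q)))
          ≤⟨ repeating-extensions (suc p) q (words (m ∸ q)) ⟩
        size (m ∸ q)
          ≡⟨ sym (*-identityˡ _) ⟩
        1 * size (m ∸ q) ∎
      where
        open ≤-Reasoning
        words-split : words m ≡ extendN q (words (m ∸ q))
        words-split = sym (trans (extendN-+ q (m ∸ q) ([] ∷ [])) (cong (λ n → words n) (m+[n∸m]≡n q≤m)))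

    extension-recurrence : ∀ m → size m * k ≤
      size (suc m) + ∑[ q < suc m ] ∑[ r < d ] (⟦ 1 ≤ᵇ period q r ⟧ * size (m ∸ q))
    extension-recurrence m = begin
        size m * k
          ≡⟨ sym (sumOver-*ʳ (λ u → ⟦ avoiding u ⟧) k (words m)) ⟩
        ∑[ u ∈ words m ] (⟦ avoiding u ⟧ * k)
          ≤⟨ sumOver-mono-All _ _ (words m) (words-length m) (λ u |u|≡m →
               subst (λ n → ⟦ avoiding u ⟧ * k ≤ extensions u + repetitions n u) |u|≡m (extensions-bound u)) ⟩
        ∑[ u ∈ words m ] (extensions u + repetitions m u)
          ≡⟨ sumOver-+ extensions (repetitions m) (words m) ⟩
        ∑[ u ∈ words m ] extensions u + ∑[ u ∈ words m ] repetitions m u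
          ≡⟨ cong₂ _+_ (sym (count-extend avoiding (words m)))
                       (trans (sumOver-sumBelow (suc m) (λ u q → ∑[ r < d ] X q r u) (words m))
                              (sumBelow-cong (suc m) _ _ λ q → sumOver-sumBelow d (λ u r → X q r u) (words m))) ⟩
        size (suc m) + ∑[ q < suc m ] ∑[ r < d ] count (λ u → avoiding u ∧ repeats (period q r) q u) (words m)
          ≤⟨ +-monoʳ-≤ (size (suc m)) (sumBelow-mono-< (suc m) _ _ λ q q<sm → sumBelow-mono d _ _ λ r →
               repeating-words (period q r) q m (≤-pred q<sm)) ⟩
        size (suc m) + ∑[ q < suc m ] ∑[ r < d ] (⟦ 1 ≤ᵇ period q r ⟧ * size (m ∸ q)) ∎
      where
        open ≤-Reasoning
        X : ℕ → ℕ → Word k → ℕ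
        X q r u = ⟦ avoiding u ∧ repeats (period q r) q u ⟧
        extensions : Word k → ℕ
        extensions u = count (λ c → avoiding (c ∷ u)) (allFin k)
        repetitions : ℕ → Word k → ℕ
        repetitions n u = ∑[ q < suc n ] ∑[ r < d ] X q r u

    shortPeriods : ℕ
    shortPeriods = ∑[ r < d ] ⟦ 1 ≤ᵇ r + s ⟧

    shortPeriods-value : ∀ d' → d ≡ suc d' → shortPeriods ≡ ⟦ 1 ≤ᵇ s ⟧ + d'
    shortPeriods-value d' refl = cong (⟦ 1 ≤ᵇ s ⟧ +_) (trans (sumBelow-const d' 1) (*-identityʳ d'))

    repetition-cost : ∀ m → ∑[ q < suc m ] ∑[ r < d ] (⟦ 1 ≤ᵇ period q r ⟧ * size (m ∸ q))
                              ≤ shortPeriods * size m + d * prefixSum size m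
    repetition-cost m = begin
        ∑[ r < d ] (⟦ 1 ≤ᵇ r + s ⟧ * size m) + ∑[ q < m ] ∑[ r < d ] (⟦ 1 ≤ᵇ period (suc q) r ⟧ * size (m ∸ suc q))
          ≤⟨ +-mono-≤ (≤-reflexive (sumBelow-*ʳ d _ (size m))) (sumBelow-mono m _ _ at-most-d) ⟩
        shortPeriods * size m + ∑[ q < m ] (d * size (m ∸ suc q))
          ≡⟨ cong (shortPeriods * size m +_) (sumBelow-*ˡ m (λ q → size (m ∸ suc q)) d) ⟩
        shortPeriods * size m + d * prefixSum size m ∎
      where
        open ≤-Reasoning
        at-most-d : ∀ q → ∑[ r < d ] (⟦ 1 ≤ᵇ period (suc q) r ⟧ * size (m ∸ suc q)) ≤ d * size (m ∸ suc q)
        at-most-d q = begin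
          ∑[ r < d ] (⟦ 1 ≤ᵇ period (suc q) r ⟧ * size (m ∸ suc q))
            ≤⟨ sumBelow-mono d _ _ (λ r → *-monoˡ-≤ (size (m ∸ suc q)) (⟦⟧≤1 (1 ≤ᵇ period (suc q) r))) ⟩
          ∑[ r < d ] (1 * size (m ∸ suc q))
            ≡⟨ trans (sumBelow-const d (1 * size (m ∸ suc q))) (cong (d *_) (*-identityˡ _)) ⟩
          d * size (m ∸ suc q) ∎

    recurrence : ∀ H → k ≡ H + shortPeriods → ∀ m → H * size m ≤ size (suc m) + d * prefixSum size m
    recurrence H k≡ m = +-cancelʳ-≤ (shortPeriods * size m) (H * size m) (size (suc m) + d * prefixSum size m) (begin
        H * size m + shortPeriods * size m
          ≡⟨ sym (*-distribʳ-+ (size m) H shortPeriods) ⟩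
        (H + shortPeriods) * size m
          ≡⟨ trans (cong (_* size m) (sym k≡)) (*-comm k (size m)) ⟩
        size m * k
          ≤⟨ extension-recurrence m ⟩
        size (suc m) + ∑[ q < suc m ] ∑[ r < d ] (⟦ 1 ≤ᵇ period q r ⟧ * size (m ∸ q))
          ≤⟨ +-monoʳ-≤ (size (suc m)) (repetition-cost m) ⟩
        size (suc m) + (shortPeriods * size m + d * prefixSum size m)
          ≡⟨ rearrange (size (suc m)) (shortPeriods * size m) (d * prefixSum size m) ⟩
        size (suc m) + d * prefixSum size m + shortPeriods * size m ∎)
      where
        open ≤-Reasoning
        rearrange : ∀ a b c → a + (b + c) ≡ a + c + b
        rearrange = solve-∀

    avoiding-suffix : ∀ (a t : Word k) → avoiding (a ++ t) ≡ true → avoiding t ≡ true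
    avoiding-suffix []      t h = h
    avoiding-suffix (c ∷ a) t h = avoiding-suffix a t (∧-conicalʳ (cleanStart (c ∷ (a ++ t))) _ h)

    avoiding-cleanStart : ∀ (t : Word k) → avoiding t ≡ true → cleanStart t ≡ true
    avoiding-cleanStart []      _ = refl
    avoiding-cleanStart (c ∷ u) h = ∧-conicalˡ (cleanStart (c ∷ u)) _ h

    cleanStart-forbids : ∀ t → cleanStart t ≡ true →
      ∀ q r → q < length t → r < d → forbidden q r t ≡ true → ⊥
    cleanStart-forbids t clean q r q<t r<d hit with subst (λ b → not b ≡ true) hit
      (allBelow-elim d _ (allBelow-elim (length t) _ clean q q<t) r r<d)
    ... | ()

    power-is-forbidden : ∀ q r (c : Fin k) x' y z j (b : Word k) →
      c ∷ x' ≡ y ++ z → period q r ≡ length (c ∷ x') →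
      length (c ∷ x') + q < length (concat (replicate j (c ∷ x')) ++ y) →
      forbidden q r ((concat (replicate j (c ∷ x')) ++ y) ++ b) ≡ true
    power-is-forbidden q r c x' y z j b X≡yz p≡P long =
      subst (λ p → repeats p (suc q) (w ++ b) ≡ true) (sym p≡P)
        (hasPeriod-intro P (suc q) (w ++ b) λ i i≤q →
          let i+P<w = ≤-<-trans (≤-trans (+-monoˡ-≤ P (≤-pred i≤q)) (≤-reflexive (+-comm q P))) long
              i<w   = ≤-<-trans (m≤m+n i P) i+P<w
          in ≤-trans i+P<w (≤-trans (m≤m+n (length w) (length b)) (≤-reflexive (sym (length-++ w)))) ,
             trans (at-++ˡ w b i i<w)
               (trans (power-periodic (c ∷ x') y z X≡yz j i i+P<w) (sym (at-++ˡ w b (i + P) i+P<w))))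
      where w = concat (replicate j (c ∷ x'))  ++ y
            P = length (c ∷ x')

    long-enough : ∀ P q r L → period q r ≡ P → d * P + P + 1 ≤ L * d + s → P + q < L
    long-enough P q r L p≡P bound = *-cancelʳ-< d (P + q) L (+-cancelʳ-< s ((P + q) * d) (L * d) (begin-strict
        (P + q) * d + s      ≡⟨ cong (_+ s) (*-distribʳ-+ d P q) ⟩
        P * d + q * d + s    ≡⟨ +-assoc (P * d) (q * d) s ⟩
        P * d + (q * d + s)  ≤⟨ +-monoʳ-≤ (P * d) (+-monoˡ-≤ s (m≤m+n (q * d) r)) ⟩
        P * d + period q r   ≡⟨ cong (P * d +_) p≡P ⟩
        P * d + P            <⟨ ≤-reflexive (trans (+-comm 1 _) (cong (λ x → x + P + 1) (*-comm P d))) ⟩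
        d * P + P + 1        ≤⟨ bound ⟩
        L * d + s ∎))
      where open ≤-Reasoning

    -- Main soundness fact: an avoiding word has no factor w that is a power of
    -- period P with exponent |w| / P ≥ (d + 1) / d (s = 1), respectively > (s = 0).
    avoiding-no-long-power : s ≤ 1 → .{{_ : NonZero d}} → ∀ u → avoiding u ≡ true →
      ∀ a w b → u ≡ a ++ w ++ b → ∀ (c : Fin k) x' j y z → c ∷ x' ≡ y ++ z →
      w ≡ concat (replicate j (c ∷ x')) ++ y →
      d * length (c ∷ x') + length (c ∷ x') + 1 ≤ length w * d + s → ⊥
    avoiding-no-long-power s≤1 u avoid a w b u≡awb c x' j y z X≡yz w≡power bound =
      cleanStart-forbids (w ++ b) (avoiding-cleanStart (w ++ b) avoid-wb) q r q<wb (m%n<n (P ∸ s) d)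
        (subst (λ v → forbidden q r (v ++ b) ≡ true) (sym w≡power)
          (power-is-forbidden q r c x' y z j b X≡yz p≡P (subst (λ v → P + q < length v) w≡power P+q<w)))
      where
        P = length (c ∷ x')
        q = (P ∸ s) / d
        r = (P ∸ s) % d
        p≡P : period q r ≡ P
        p≡P = trans (cong (_+ s) (trans (+-comm (q * d) r) (sym (m≡m%n+[m/n]*n (P ∸ s) d))))
                    (m∸n+n≡m (≤-trans s≤1 (s≤s z≤n)))
        P+q<w : P + q < length w
        P+q<w = long-enough P q r (length w) p≡P bound
        q<wb : q < length (w ++ b)
        q<wb = ≤-trans (≤-trans (s≤s (m≤n+m q P)) P+q<w)
                       (≤-trans (m≤m+n (length w) (length b)) (≤-reflexive (sym (length-++ w))))
        avoid-wb : avoiding (w ++ b) ≡ true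
        avoid-wb = avoiding-suffix a (w ++ b) (subst (λ v → avoiding v ≡ true) u≡awb avoid)

module SequenceGrowth where
  open import Data.Nat using (ℕ; zero; suc; _+_; _*_; _≤_; z≤n; NonZero)
  open import Data.Nat.Properties
  open import Relation.Binary.PropositionalEquality
  open import Data.Nat.Tactic.RingSolver using (solve-∀)
  open Sums

  -- The proof keeps the invariant Q (a(m - 1) + ⋯ + a(0)) ≤ a(m), i.e. the
  -- sequence grows by a factor Q + 1 at least.
  module _ (a : ℕ → ℕ) (H d : ℕ) (recurrence : ∀ m → H * a m ≤ a (suc m) + d * prefixSum a m)
                (Q P : ℕ) .{{_ : NonZero Q}} (Q²+Q≤P : Q * Q + Q ≤ P) (P+d≡QH : P + d ≡ Q * H) where

    step : ∀ m → Q * prefixSum a m ≤ a m → (P + d) * a m ≤ Q * a (suc m) + d * a m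
    step m inv = begin
        (P + d) * a m                       ≡⟨ cong (_* a m) P+d≡QH ⟩
        Q * H * a m                         ≡⟨ *-assoc Q H (a m) ⟩
        Q * (H * a m)                       ≤⟨ *-monoʳ-≤ Q (recurrence m) ⟩
        Q * (a (suc m) + d * prefixSum a m) ≡⟨ distribute Q (a (suc m)) d (prefixSum a m) ⟩
        Q * a (suc m) + d * (Q * prefixSum a m) ≤⟨ +-monoʳ-≤ (Q * a (suc m)) (*-monoʳ-≤ d inv) ⟩
        Q * a (suc m) + d * a m ∎
      where
        open ≤-Reasoning
        distribute : ∀ Q a₁ d b → Q * (a₁ + d * b) ≡ Q * a₁ + d * (Q * b)
        distribute = solve-∀

    invariant : ∀ m → Q * prefixSum a m ≤ a m
    invariant zero    = ≤-trans (≤-reflexive (*-zeroʳ Q)) z≤n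
    invariant (suc m) = begin
        Q * (a m + prefixSum a m)  ≡⟨ *-distribˡ-+ Q (a m) (prefixSum a m) ⟩
        Q * a m + Q * prefixSum a m ≤⟨ +-monoʳ-≤ (Q * a m) (invariant m) ⟩
        Q * a m + a m              ≤⟨ *-cancelˡ-≤ Q Q[Q+1]a≤Qa' ⟩
        a (suc m) ∎
      where
        open ≤-Reasoning
        regroup : ∀ Q a → (Q * Q + Q) * a ≡ Q * (Q * a + a)
        regroup = solve-∀
        Q[Q+1]a≤Qa' : Q * (Q * a m + a m) ≤ Q * a (suc m)
        Q[Q+1]a≤Qa' = +-cancelʳ-≤ (d * a m) _ _ (begin
          Q * (Q * a m + a m) + d * a m ≡⟨ cong (_+ d * a m) (sym (regroup Q (a m))) ⟩
          (Q * Q + Q) * a m + d * a m   ≡⟨ sym (*-distribʳ-+ (a m) (Q * Q + Q) d) ⟩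
          (Q * Q + Q + d) * a m         ≤⟨ *-monoˡ-≤ (a m) (+-monoˡ-≤ d Q²+Q≤P) ⟩
          (P + d) * a m                 ≤⟨ step m (invariant m) ⟩
          Q * a (suc m) + d * a m ∎)

    growth : ∀ m → P * a m ≤ Q * a (suc m)
    growth m = +-cancelʳ-≤ (d * a m) (P * a m) (Q * a (suc m))
      (≤-trans (≤-reflexive (sym (*-distribʳ-+ (a m) P d))) (step m (invariant m)))

module Fractions where
  open import Data.Nat as ℕ using (ℕ; zero; suc; _≤_; _<_; z≤n)
  import Data.Nat.Properties as ℕ
  open import Data.Integer as ℤ using (+_)
  import Data.Integer.Properties as ℤ
  open import Data.Rational as ℚ using (ℚ; _/_; 0ℚ; toℚᵘ)
  import Data.Rational.Properties as ℚ
  open import Data.Rational.Unnormalised as ℚᵘ using (ℚᵘ; mkℚᵘ; *≤*; *<*; *≡*)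
  import Data.Rational.Unnormalised.Properties as ℚᵘ
  open import Algebra.Properties.Group ℚ.+-0-group using (//-rightDividesʳ)
  open import Relation.Binary.PropositionalEquality
  open import Defs using (_^ℚ_)

  -- Fractions of naturals a / (b + 1) are compared and combined through their
  -- unnormalised representatives, i.e. by cross-multiplication.
  private
    representative : ∀ z b → toℚᵘ (z / suc b) ℚᵘ.≃ mkℚᵘ z b
    representative z b = ℚ.toℚᵘ-fromℚᵘ (mkℚᵘ z b)

  frac-≤⁻ : ∀ a b c e → (+ a) / suc b ℚ.≤ (+ c) / suc e → a ℕ.* suc e ≤ c ℕ.* suc b
  frac-≤⁻ a b c e le
    with ℚᵘ.≤-respʳ-≃ (representative (+ c) e) (ℚᵘ.≤-respˡ-≃ (representative (+ a) b) (ℚ.toℚᵘ-mono-≤ le))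
  ... | *≤* cross = ℤ.drop‿+≤+ (subst₂ ℤ._≤_ (sym (ℤ.pos-* a (suc e))) (sym (ℤ.pos-* c (suc b))) cross)

  frac-<⁻ : ∀ a b c e → (+ a) / suc b ℚ.< (+ c) / suc e → a ℕ.* suc e < c ℕ.* suc b
  frac-<⁻ a b c e lt
    with ℚᵘ.<-respʳ-≃ (representative (+ c) e) (ℚᵘ.<-respˡ-≃ (representative (+ a) b) (ℚ.toℚᵘ-mono-< lt))
  ... | *<* cross = ℤ.drop‿+<+ (subst₂ ℤ._<_ (sym (ℤ.pos-* a (suc e))) (sym (ℤ.pos-* c (suc b))) cross)

  frac-≤ : ∀ a b c e → a ℕ.* suc e ≤ c ℕ.* suc b → (+ a) / suc b ℚ.≤ (+ c) / suc e
  frac-≤ a b c e cross = ℚ.toℚᵘ-cancel-≤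
    (ℚᵘ.≤-respˡ-≃ (ℚᵘ.≃-sym (representative (+ a) b)) (ℚᵘ.≤-respʳ-≃ (ℚᵘ.≃-sym (representative (+ c) e))
      (*≤* (subst₂ ℤ._≤_ (ℤ.pos-* a (suc e)) (ℤ.pos-* c (suc b)) (ℤ.+≤+ cross)))))

  frac-< : ∀ a b c e → a ℕ.* suc e < c ℕ.* suc b → (+ a) / suc b ℚ.< (+ c) / suc e
  frac-< a b c e cross = ℚ.toℚᵘ-cancel-<
    (ℚᵘ.<-respˡ-≃ (ℚᵘ.≃-sym (representative (+ a) b)) (ℚᵘ.<-respʳ-≃ (ℚᵘ.≃-sym (representative (+ c) e))
      (*<* (subst₂ ℤ._<_ (ℤ.pos-* a (suc e)) (ℤ.pos-* c (suc b)) (ℤ.+<+ cross)))))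

  frac-≡ : ∀ a b c e → a ℕ.* suc e ≡ c ℕ.* suc b → (+ a) / suc b ≡ (+ c) / suc e
  frac-≡ a b c e cross = ℚ.toℚᵘ-injective
    (ℚᵘ.≃-trans (representative (+ a) b) (ℚᵘ.≃-trans
      (*≡* (trans (sym (ℤ.pos-* a (suc e))) (trans (cong +_ cross) (ℤ.pos-* c (suc b)))))
      (ℚᵘ.≃-sym (representative (+ c) e))))

  frac-+ : ∀ a b c e → (+ a) / suc b ℚ.+ (+ c) / suc e ≡ (+ (a ℕ.* suc e ℕ.+ c ℕ.* suc b)) / (suc b ℕ.* suc e)
  frac-+ a b c e = ℚ.toℚᵘ-injective (ℚᵘ.≃-trans (ℚ.toℚᵘ-homo-+ ((+ a) / suc b) ((+ c) / suc e))
    (ℚᵘ.≃-trans (ℚᵘ.+-cong (representative (+ a) b) (representative (+ c) e))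
      (ℚᵘ.≃-trans (*≡* (cong (ℤ._* (+ suc (e ℕ.+ b ℕ.* suc e))) numerator))
                  (ℚᵘ.≃-sym (representative (+ (a ℕ.* suc e ℕ.+ c ℕ.* suc b)) (e ℕ.+ b ℕ.* suc e))))))
    where
      numerator : + a ℤ.* + suc e ℤ.+ + c ℤ.* + suc b ≡ + (a ℕ.* suc e ℕ.+ c ℕ.* suc b)
      numerator = trans (cong₂ ℤ._+_ (sym (ℤ.pos-* a (suc e))) (sym (ℤ.pos-* c (suc b))))
                        (sym (ℤ.pos-+ (a ℕ.* suc e) (c ℕ.* suc b)))

  frac-* : ∀ a b c e → (+ a) / suc b ℚ.* ((+ c) / suc e) ≡ (+ (a ℕ.* c)) / (suc b ℕ.* suc e)
  frac-* a b c e = ℚ.toℚᵘ-injective (ℚᵘ.≃-trans (ℚ.toℚᵘ-homo-* ((+ a) / suc b) ((+ c) / suc e))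
    (ℚᵘ.≃-trans (ℚᵘ.*-cong (representative (+ a) b) (representative (+ c) e))
      (ℚᵘ.≃-trans (*≡* (cong (ℤ._* (+ suc (e ℕ.+ b ℕ.* suc e))) (sym (ℤ.pos-* a c))))
                  (ℚᵘ.≃-sym (representative (+ (a ℕ.* c)) (e ℕ.+ b ℕ.* suc e))))))

  nat-nonNeg : ∀ a → 0ℚ ℚ.≤ (+ a) / 1
  nat-nonNeg a = frac-≤ 0 0 a 0 z≤n

  nat-∸ : ∀ h n → (+ (h ℕ.+ n)) / 1 ℚ.- (+ n) / 1 ≡ (+ h) / 1
  nat-∸ h n = begin
      (+ (h ℕ.+ n)) / 1 ℚ.- (+ n) / 1
        ≡⟨ cong (ℚ._- (+ n) / 1) (sym (trans (frac-+ h 0 n 0) (frac-≡ (h ℕ.* 1 ℕ.+ n ℕ.* 1) 0 (h ℕ.+ n) 0 sum-numerator))) ⟩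
      ((+ h) / 1 ℚ.+ (+ n) / 1) ℚ.- (+ n) / 1
        ≡⟨ //-rightDividesʳ ((+ n) / 1) ((+ h) / 1) ⟩
      (+ h) / 1 ∎
    where
      open ≡-Reasoning
      sum-numerator : (h ℕ.* 1 ℕ.+ n ℕ.* 1) ℕ.* 1 ≡ (h ℕ.+ n) ℕ.* 1
      sum-numerator = cong (ℕ._* 1) (cong₂ ℕ._+_ (ℕ.*-identityʳ h) (ℕ.*-identityʳ n))

  power-lower-bound : ∀ (q : ℚ) P Q-1 (a : ℕ → ℕ) → 0ℚ ℚ.≤ q → q ℚ.≤ (+ P) / suc Q-1 → a 0 ≡ 1 →
    (∀ m → P ℕ.* a m ≤ suc Q-1 ℕ.* a (suc m)) → ∀ m → q ^ℚ m ℚ.≤ (+ a m) / 1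
  power-lower-bound q P Q-1 a 0≤q q≤P/Q a₀≡1 growth zero rewrite a₀≡1 = ℚ.≤-refl
  power-lower-bound q P Q-1 a 0≤q q≤P/Q a₀≡1 growth (suc m) = begin
      q ℚ.* q ^ℚ m                         ≤⟨ ℚ.*-monoˡ-≤-nonNeg q {{ℚ.nonNegative 0≤q}}
                                                (power-lower-bound q P Q-1 a 0≤q q≤P/Q a₀≡1 growth m) ⟩
      q ℚ.* ((+ a m) / 1)                  ≤⟨ ℚ.*-monoʳ-≤-nonNeg ((+ a m) / 1) {{ℚ.nonNegative (nat-nonNeg (a m))}} q≤P/Q ⟩
      (+ P) / suc Q-1 ℚ.* ((+ a m) / 1)    ≡⟨ frac-* P Q-1 (a m) 0 ⟩
      (+ (P ℕ.* a m)) / (suc Q-1 ℕ.* 1)   ≤⟨ frac-≤ (P ℕ.* a m) (ℕ.pred (suc Q-1 ℕ.* 1)) (a (suc m)) 0 cross ⟩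
      (+ a (suc m)) / 1 ∎
    where
      open ℚ.≤-Reasoning
      cross : P ℕ.* a m ℕ.* 1 ≤ a (suc m) ℕ.* (suc Q-1 ℕ.* 1)
      cross = subst₂ _≤_ (sym (ℕ.*-identityʳ _))
                     (trans (ℕ.*-comm (suc Q-1) (a (suc m))) (cong (a (suc m) ℕ.*_) (sym (ℕ.*-identityʳ _))))
                     (growth m)

module LowerBound where
  open import Data.Nat as ℕ using (ℕ; zero; suc; _≤_; _<_; z≤n; s≤s; _≤ᵇ_)
  import Data.Nat.Properties as ℕ
  open import Data.Integer using (+_)
  open import Data.Rational as ℚ using (ℚ; _/_; 0ℚ)
  import Data.Rational.Properties as ℚ
  open import Data.Bool using (true; false)
  import Data.Bool as Bool
  open import Data.Fin using (Fin)
  open import Data.List using (List; []; _∷_; length; filter)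
  import Data.List.Relation.Unary.All as All
  import Data.List.Relation.Unary.All.Properties as All
  open import Data.List.Relation.Unary.Unique.Propositional using (Unique)
  import Data.List.Relation.Unary.AllPairs as AllPairs
  import Data.List.Relation.Unary.Unique.Propositional.Properties as Unique
  open import Data.Product using (_,_; _×_)
  open import Relation.Binary.PropositionalEquality
  open import Data.Nat.Tactic.RingSolver using (solve-∀)
  open import Algebra.Properties.Group ℚ.+-0-group using (//-rightDividesʳ)
  open import Defs
  open Sums
  open Avoidance
  open Fractions
  open SequenceGrowth using (growth)

  module Enumeration (k d s : ℕ) where
    open AvoidingWords k d s

    avoidingWords : ℕ → List (Word k)
    avoidingWords m = filter (λ u → avoiding u Bool.≟ true) (words m)

    length-filter-avoiding : ∀ us → length (filter (λ u → avoiding u Bool.≟ true) us) ≡ count avoiding us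
    length-filter-avoiding []       = refl
    length-filter-avoiding (u ∷ us) with avoiding u
    ... | true  = cong suc (length-filter-avoiding us)
    ... | false = length-filter-avoiding us

    words-unique : ∀ m → Unique (words m)
    words-unique zero    = All.[] AllPairs.∷ AllPairs.[]
    words-unique (suc m) = Unique.cartesianProductWith⁺ (λ u c → c ∷ u) cons-injective (words-unique m) (Unique.allFin⁺ k)
      where cons-injective : ∀ {u v : Word k} {c e : Fin k} → c ∷ u ≡ e ∷ v → u ≡ v × c ≡ e
            cons-injective refl = refl , refl

    enumeration : (F : Word k → Set) → (∀ u → avoiding u ≡ true → F u) → ∀ m →
      Unique (avoidingWords m) × All.All (λ u → length u ≡ m × F u) (avoidingWords m)
        × length (avoidingWords m) ≡ size m
    enumeration F sound m =
      Unique.filter⁺ (λ u → avoiding u Bool.≟ true) (words-unique m) ,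
      All.zipWith (λ (|u|≡m , avoid) → |u|≡m , sound _ avoid)
        (All.filter⁺ (λ u → avoiding u Bool.≟ true) (words-length m) ,
         All.all-filter (λ u → avoiding u Bool.≟ true) (words m)) ,
      length-filter-avoiding (words m)

  avoiding-growth : ∀ k d s H Q-1 P (F : Word k → Set) (r : ℚ) →
    (∀ u → AvoidingWords.avoiding k d s u ≡ true → F u) →
    k ≡ H ℕ.+ AvoidingWords.shortPeriods k d s →
    suc Q-1 ℕ.* suc Q-1 ℕ.+ suc Q-1 ≤ P → P ℕ.+ d ≡ suc Q-1 ℕ.* H →
    r ℚ.≤ (+ P) / suc Q-1 → GrowthRateAtLeast {k} F r
  avoiding-growth k d s H Q-1 P F r sound k≡ Q²+Q≤P P+d≡QH r≤P/Q q 0≤q q<r = 0 , λ m _ →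
    let (unique , all , length≡size) = enumeration F sound m in
    avoidingWords m , unique , all ,
    subst (λ L → q ^ℚ m ℚ.≤ (+ L) / 1) (sym length≡size)
      (power-lower-bound q P Q-1 size 0≤q (ℚ.<⇒≤ (ℚ.<-≤-trans q<r r≤P/Q)) refl
       (growth size H d (recurrence H k≡) (suc Q-1) P Q²+Q≤P P+d≡QH) m)
    where
      open AvoidingWords k d s
      open Enumeration k d s

  -- Avoiding words for d = n - 1 are n/(n-1)-free (s = 1) and n/(n-1)⁺-free (s = 0):
  -- a power of period P and exponent γ ≥ n/(n-1) has n P ≤ (n - 1) |w|.
  avoiding-free : ∀ {k} n0 (u : Word k) → AvoidingWords.avoiding k (suc n0) 1 u ≡ true →
    Free {k} ((+ suc (suc n0)) / suc n0) u
  avoiding-free {k} n0 u avoid (a , w , b , γ , u≡awb , (c , x' , j , y , z , X≡yz , w≡power , γ≡) , β≤γ) =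
    AvoidingWords.avoiding-no-long-power k (suc n0) 1 (s≤s z≤n) u avoid a w b u≡awb c x' j y z X≡yz w≡power
      (ℕ.+-monoˡ-≤ 1 (subst (_≤ length w ℕ.* suc n0) (ℕ.+-comm P (suc n0 ℕ.* P)) nP≤dw))
    where
      P = suc (length x')
      nP≤dw : suc (suc n0) ℕ.* P ≤ length w ℕ.* suc n0
      nP≤dw = frac-≤⁻ (suc (suc n0)) n0 (length w) (length x') (subst ((+ suc (suc n0)) / suc n0 ℚ.≤_) γ≡ β≤γ)

  avoiding-free⁺ : ∀ {k} n0 (u : Word k) → AvoidingWords.avoiding k (suc n0) 0 u ≡ true →
    Free⁺ {k} ((+ suc (suc n0)) / suc n0) u
  avoiding-free⁺ {k} n0 u avoid (a , w , b , γ , u≡awb , (c , x' , j , y , z , X≡yz , w≡power , γ≡) , β<γ) =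
    AvoidingWords.avoiding-no-long-power k (suc n0) 0 z≤n u avoid a w b u≡awb c x' j y z X≡yz w≡power
      (subst₂ _≤_ (trans (cong suc (ℕ.+-comm P (suc n0 ℕ.* P))) (ℕ.+-comm 1 _)) (sym (ℕ.+-identityʳ _)) nP<dw)
    where
      P = suc (length x')
      nP<dw : suc (suc n0) ℕ.* P < length w ℕ.* suc n0
      nP<dw = frac-<⁻ (suc (suc n0)) n0 (length w) (length x') (subst ((+ suc (suc n0)) / suc n0 ℚ.<_) γ≡ β<γ)

  -- The parameters for n = n0 + 2 and k = 4n + t, with e = 0 for n/(n-1)-free
  -- words (s = 1) and e = 1 for n/(n-1)⁺-free words (s = 0).  The recurrence
  -- grows by P / Q = H - d / Q with Q = k - 2n and H = k + 1 + e - n, and the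
  -- loss d / Q - d / k = 2 n d / (k Q) is at most C / k² with C = 4n², as k ≥ 4n.
  module ParameterChoice (n0 t e : ℕ) where
    n d k Q H C P : ℕ
    n = 2 ℕ.+ n0
    d = 1 ℕ.+ n0
    k = 4 ℕ.* n ℕ.+ t
    Q = 2 ℕ.* n ℕ.+ t
    H = 3 ℕ.* n ℕ.+ t ℕ.+ 1 ℕ.+ e
    C = 4 ℕ.* n ℕ.* n
    P = Q ℕ.* Q ℕ.+ Q ℕ.+ (Q ℕ.* d ℕ.+ e ℕ.* Q ℕ.+ n ℕ.+ t ℕ.+ 1)   -- = Q H - d

    P+d≡QH : P ℕ.+ d ≡ Q ℕ.* H
    P+d≡QH = identity n0 t e
      where identity : ∀ n0 t e → let n = 2 ℕ.+ n0 ; d = 1 ℕ.+ n0 ; Q = 2 ℕ.* n ℕ.+ t in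
              Q ℕ.* Q ℕ.+ Q ℕ.+ (Q ℕ.* d ℕ.+ e ℕ.* Q ℕ.+ n ℕ.+ t ℕ.+ 1) ℕ.+ d ≡ Q ℕ.* (3 ℕ.* n ℕ.+ t ℕ.+ 1 ℕ.+ e)
            identity = solve-∀

    Q²+Q≤P : Q ℕ.* Q ℕ.+ Q ≤ P
    Q²+Q≤P = ℕ.m≤m+n (Q ℕ.* Q ℕ.+ Q) _

    k+1+e≡H+n : k ℕ.+ (1 ℕ.+ e) ≡ H ℕ.+ n
    k+1+e≡H+n = identity n0 t e
      where identity : ∀ n0 t e → let n = 2 ℕ.+ n0 in
              4 ℕ.* n ℕ.+ t ℕ.+ (1 ℕ.+ e) ≡ 3 ℕ.* n ℕ.+ t ℕ.+ 1 ℕ.+ e ℕ.+ n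
            identity = solve-∀

    -- k - H = d - e is the number shortPeriods of letters lost, for q = 0, to the
    -- periods r + s with r < d.
    k≡H+[d∸e] : e ≤ 1 → k ≡ H ℕ.+ (d ℕ.∸ e)
    k≡H+[d∸e] z≤n       = identity n0 t
      where identity : ∀ n0 t → 4 ℕ.* (2 ℕ.+ n0) ℕ.+ t ≡ 3 ℕ.* (2 ℕ.+ n0) ℕ.+ t ℕ.+ 1 ℕ.+ 0 ℕ.+ (1 ℕ.+ n0)
            identity = solve-∀
    k≡H+[d∸e] (s≤s z≤n) = identity n0 t
      where identity : ∀ n0 t → 4 ℕ.* (2 ℕ.+ n0) ℕ.+ t ≡ 3 ℕ.* (2 ℕ.+ n0) ℕ.+ t ℕ.+ 1 ℕ.+ 1 ℕ.+ n0
            identity = solve-∀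

    quadratic errorTerms : ℚ
    quadratic  = (+ C) / 1 ℚ.* ((+ 1) / k) ℚ.* ((+ 1) / k)
    errorTerms = (+ d) / k ℚ.+ quadratic

    error-fraction : errorTerms ≡ (+ (d ℕ.* (1 ℕ.* k ℕ.* k) ℕ.+ C ℕ.* 1 ℕ.* 1 ℕ.* k)) / (k ℕ.* (1 ℕ.* k ℕ.* k))
    error-fraction = begin
        (+ d) / k ℚ.+ (+ C) / 1 ℚ.* ((+ 1) / k) ℚ.* ((+ 1) / k)
          ≡⟨ cong (λ x → (+ d) / k ℚ.+ x ℚ.* ((+ 1) / k)) (frac-* C 0 1 (ℕ.pred k)) ⟩
        (+ d) / k ℚ.+ (+ (C ℕ.* 1)) / (1 ℕ.* k) ℚ.* ((+ 1) / k)
          ≡⟨ cong ((+ d) / k ℚ.+_) (frac-* (C ℕ.* 1) (ℕ.pred (1 ℕ.* k)) 1 (ℕ.pred k)) ⟩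
        (+ d) / k ℚ.+ (+ (C ℕ.* 1 ℕ.* 1)) / (1 ℕ.* k ℕ.* k)
          ≡⟨ frac-+ d (ℕ.pred k) (C ℕ.* 1 ℕ.* 1) (ℕ.pred (1 ℕ.* k ℕ.* k)) ⟩
        (+ (d ℕ.* (1 ℕ.* k ℕ.* k) ℕ.+ C ℕ.* 1 ℕ.* 1 ℕ.* k)) / (k ℕ.* (1 ℕ.* k ℕ.* k)) ∎
      where open ≡-Reasoning

    d/Q≤errorTerms : (+ d) / Q ℚ.≤ errorTerms
    d/Q≤errorTerms = subst ((+ d) / Q ℚ.≤_) (sym error-fraction)
      (frac-≤ d (ℕ.pred Q) (d ℕ.* (1 ℕ.* k ℕ.* k) ℕ.+ C ℕ.* 1 ℕ.* 1 ℕ.* k) (ℕ.pred (k ℕ.* (1 ℕ.* k ℕ.* k)))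
        (subst (d ℕ.* (k ℕ.* (1 ℕ.* k ℕ.* k)) ≤_) (sym (expand n0 t)) (ℕ.m≤m+n _ _)))
      where
        expand : ∀ n0 t → let n = 2 ℕ.+ n0 ; d = 1 ℕ.+ n0 ; k = 4 ℕ.* n ℕ.+ t ; Q = 2 ℕ.* n ℕ.+ t ; C = 4 ℕ.* n ℕ.* n in
          (d ℕ.* (1 ℕ.* k ℕ.* k) ℕ.+ C ℕ.* 1 ℕ.* 1 ℕ.* k) ℕ.* Q
            ≡ d ℕ.* (k ℕ.* (1 ℕ.* k ℕ.* k)) ℕ.+ 2 ℕ.* n ℕ.* k ℕ.* (4 ℕ.* n ℕ.+ t ℕ.* (n ℕ.+ 1))
        expand = solve-∀

    rate : (+ P) / Q ≡ (+ H) / 1 ℚ.- (+ d) / Q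
    rate = begin
        (+ P) / Q                                ≡⟨ sym (//-rightDividesʳ ((+ d) / Q) ((+ P) / Q)) ⟩
        ((+ P) / Q ℚ.+ (+ d) / Q) ℚ.- (+ d) / Q  ≡⟨ cong (ℚ._- (+ d) / Q) sum≡H ⟩
        (+ H) / 1 ℚ.- (+ d) / Q                  ∎
      where
        open ≡-Reasoning
        QHQ : ∀ Q H → Q ℕ.* H ℕ.* Q ≡ H ℕ.* (Q ℕ.* Q)
        QHQ = solve-∀
        sum≡H : (+ P) / Q ℚ.+ (+ d) / Q ≡ (+ H) / 1
        sum≡H = trans (frac-+ P (ℕ.pred Q) d (ℕ.pred Q))
          (frac-≡ (P ℕ.* Q ℕ.+ d ℕ.* Q) (ℕ.pred (Q ℕ.* Q)) H 0
            (trans (ℕ.*-identityʳ _) (trans (sym (ℕ.*-distribʳ-+ Q P d)) (trans (cong (ℕ._* Q) P+d≡QH) (QHQ Q H)))))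

    bound≤rate : (+ (k ℕ.+ (1 ℕ.+ e))) / 1 ℚ.- (+ n) / 1 ℚ.- (+ d) / k ℚ.- quadratic ℚ.≤ (+ P) / Q
    bound≤rate = begin
        (+ (k ℕ.+ (1 ℕ.+ e))) / 1 ℚ.- (+ n) / 1 ℚ.- (+ d) / k ℚ.- quadratic
          ≡⟨ ℚ.+-assoc ((+ (k ℕ.+ (1 ℕ.+ e))) / 1 ℚ.- (+ n) / 1) (ℚ.- ((+ d) / k)) (ℚ.- quadratic) ⟩
        ((+ (k ℕ.+ (1 ℕ.+ e))) / 1 ℚ.- (+ n) / 1) ℚ.+ (ℚ.- ((+ d) / k) ℚ.- quadratic)
          ≡⟨ cong₂ ℚ._+_ (trans (cong (λ x → (+ x) / 1 ℚ.- (+ n) / 1) k+1+e≡H+n) (nat-∸ H n))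
                         (sym (ℚ.neg-distrib-+ ((+ d) / k) quadratic)) ⟩
        (+ H) / 1 ℚ.- errorTerms
          ≤⟨ ℚ.+-monoʳ-≤ ((+ H) / 1) (ℚ.neg-antimono-≤ d/Q≤errorTerms) ⟩
        (+ H) / 1 ℚ.- (+ d) / Q
          ≡⟨ sym rate ⟩
        (+ P) / Q ∎
      where open ℚ.≤-Reasoning

    claimed-growth : ∀ s (F : Word k → Set) → (∀ u → AvoidingWords.avoiding k d s u ≡ true → F u) →
      e ≤ 1 → ⟦ 1 ≤ᵇ s ⟧ ℕ.+ n0 ≡ d ℕ.∸ e →
      GrowthRateAtLeast {k} F ((+ (k ℕ.+ (1 ℕ.+ e))) / 1 ℚ.- (+ n) / 1 ℚ.- (+ d) / k ℚ.- quadratic)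
    claimed-growth s F sound e≤1 short≡ = avoiding-growth k d s H (ℕ.pred Q) P F _ sound
      (trans (k≡H+[d∸e] e≤1) (cong (H ℕ.+_) (trans (sym short≡) (sym (AvoidingWords.shortPeriods-value k d s n0 refl)))))
      Q²+Q≤P P+d≡QH bound≤rate

open import Data.Nat using (ℕ; _≤_; _∸_; _+_; NonZero)
open import Data.Integer using (+_)
open import Data.Rational using (ℚ; _/_; _-_; _*_; _<_; 0ℚ)
open import Data.Product using (Σ; _×_)
open import Defs
open import Data.Nat using (zero; suc; z≤n; s≤s)
import Data.Nat as ℕ
open import Data.Nat.Properties using (m+[n∸m]≡n)
open import Data.Product using (_,_)
open import Relation.Binary.PropositionalEquality using (_≡_; refl; sym)
open Fractions using (frac-<)
open LowerBound using (module ParameterChoice; avoiding-free; avoiding-free⁺)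

theorem1 : (n : ℕ) → (hn : 2 ≤ n) →
    Σ ℚ λ C → Σ ℕ λ K → 0ℚ < C ×
      (∀ (k : ℕ) → .{{_ : NonZero k}} → K ≤ k →
        GrowthRateAtLeast {k} (Free (nOverNm1 n hn))
          ((+ (k + 1)) / 1 - (+ n) / 1 - (+ (n ∸ 1)) / k - C * ((+ 1) / k) * ((+ 1) / k))
        ×
        GrowthRateAtLeast {k} (Free⁺ (nOverNm1 n hn))
          ((+ (k + 2)) / 1 - (+ n) / 1 - (+ (n ∸ 1)) / k - C * ((+ 1) / k) * ((+ 1) / k)))
theorem1 (suc zero) (s≤s ())
theorem1 n@(suc (suc n0)) hn =
  (+ C) / 1 , 4 ℕ.* n , frac-< 0 0 C 0 (s≤s z≤n) , λ k K≤k → bounds k (k ∸ 4 ℕ.* n) (sym (m+[n∸m]≡n K≤k))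
  where
    C = 4 ℕ.* n ℕ.* n
    -- Write k = 4n + t; the two bounds are the cases e = 0 (s = 1) and e = 1 (s = 0).
    bounds : ∀ k .{{_ : NonZero k}} t → k ≡ 4 ℕ.* n + t →
      GrowthRateAtLeast {k} (Free (nOverNm1 n hn))
        ((+ (k + 1)) / 1 - (+ n) / 1 - (+ (n ∸ 1)) / k - (+ C) / 1 * ((+ 1) / k) * ((+ 1) / k))
      ×
      GrowthRateAtLeast {k} (Free⁺ (nOverNm1 n hn))
        ((+ (k + 2)) / 1 - (+ n) / 1 - (+ (n ∸ 1)) / k - (+ C) / 1 * ((+ 1) / k) * ((+ 1) / k))
    bounds _ t refl =
      ParameterChoice.claimed-growth n0 t 0 1 _ (avoiding-free n0) z≤n refl ,
      ParameterChoice.claimed-growth n0 t 1 0 _ (avoiding-free⁺ n0) (s≤s z≤n) refl
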